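{- Let $\varphi$, $\psi$, $\gamma$ be formulas of $\mathrm{cCTL}^*_f$ (counting $\mathrm{CTL}^*$ with path quantification over finite paths). For formulas $\varphi,\psi$ put $\alpha^{R}_{\varphi,\psi} = \psi \,\mathsf{U}\, ((\tilde{\mathsf{X}}\bot \vee \varphi)\wedge \psi)$ and $\alpha^{U}_{\varphi,\psi} = \psi \,\mathsf{R}\, ((\mathsf{X}\top \wedge \varphi)\vee \psi)$. Then each of the following biconditionals is a valid $\mathrm{cCTL}^*_f$ equivalence (i.e. the two sides are equivalent): 1. $\mathsf{E}\tilde{\mathsf{X}}\varphi \leftrightarrow \top$ and $\mathsf{A}\mathsf{X}\varphi \leftrightarrow \bot$; 2. $\varphi \,\mathsf{R}\, \psi \leftrightarrow \alpha^{R}_{\varphi,\psi}$ and $\varphi \,\mathsf{U}\, \psi \leftrightarrow \alpha^{U}_{\varphi,\psi}$; 3. $\mathsf{E}(\varphi \,\mathsf{R}\, \psi) \leftrightarrow \mathsf{E}(\alpha^{R}_{\varphi,\psi})$ and $\mathsf{A}(\varphi \,\mathsf{U}\, \psi) \leftrightarrow \mathsf{A}(\alpha^{U}_{\varphi,\psi})$; 4. $\mathsf{E}\mathsf{X}(\varphi \,\mathsf{R}\, \psi) \leftrightarrow \mathsf{E}\mathsf{X}(\alpha^{R}_{\varphi,\psi})$ and $\mathsf{A}\tilde{\mathsf{X}}(\varphi \,\mathsf{U}\, \psi) \leftrightarrow \mathsf{A}\tilde{\mathsf{X}}(\alpha^{U}_{\varphi,\psi})$; 5. $\mathsf{E}(\varphi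 \,\mathsf{U}\, (\psi \,\mathsf{R}\, \gamma)) \leftrightarrow \mathsf{E}(\varphi \,\mathsf{U}\, \alpha^{R}_{\psi,\gamma})$ and $\mathsf{A}(\varphi \,\mathsf{R}\, (\psi \,\mathsf{U}\, \gamma)) \leftrightarrow \mathsf{A}(\varphi \,\mathsf{R}\, \alpha^{U}_{\psi,\gamma})$; 6. $\mathsf{E}((\varphi \,\mathsf{R}\, \psi) \,\mathsf{U}\, \gamma) \leftrightarrow \mathsf{E}(\alpha^{R}_{\varphi,\psi} \,\mathsf{U}\, \gamma)$ and $\mathsf{A}((\varphi \,\mathsf{U}\, \psi) \,\mathsf{R}\, \gamma) \leftrightarrow \mathsf{A}(\alpha^{U}_{\varphi,\psi} \,\mathsf{R}\, \gamma)$.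
   Context: Trees: a tree $T=(V_T,E_T)$ is a connected acyclic directed graph with a root $\epsilon_T$, every node having finitely many but at least one child (unranked, unordered, infinite, finitely branching). A path is a finite or infinite sequence of nodes starting at the root in which each element after the first is a child of its predecessor; $\pi(i)$ denotes its $i$-th node (positions start at $0$). Fix a finite set $AP$ of atomic propositions and $\Sigma=2^{AP}$; a $\Sigma$-tree is $\mathcal T=(T,\tau)$ with $\tau:V_T\to\Sigma$. Syntax of $\mathrm{cCTL}^*_f$: $\varphi ::= \mathsf{D}^n\varphi \mid p \mid \neg\varphi \mid \varphi\vee\varphi \mid \mathsf{E}\varphi \mid \mathsf{X}\varphi \mid \varphi\,\mathsf{U}\,\varphi$, with $n\in\mathbb N$, $p\in AP$. Semantics over a $\Sigma$-tree $\mathcal T$, a finite non-empty path $\pi$ and a position $i$ of $\pi$ (Boolean cases as usual): $\mathcal T,\pi,i\models \mathsf{D}^n\psi$ iff $\pi$ does not end at $\pi(i)$ and there are $n$ distinct finite paths $\pi_1,\dots,\pi_n$ that coincide with $\pi$ up to position $i$, pairwise differ at position $i+1$, and satisfy $\mathcal T,\pi_j,i+1\models\psi$ for all $j$; $\mathcal T,\pi,i\models p$ iff $p\in\tau(\pi(i))$; $\mathcal T,\pi,i\models \mathsf{E}\psi$ iff there is a finite path $\pi'$ coinciding with $\pi$ up to position $i$ with $\mathcal T,\pi',i\models\psi$; $\mathcal T,\pi,i\models \mathsf{X}\psi$ iff $\pi$ does not end at $\pi(i)$ and $\mathcal T,\pi,i+1\models\psi$; $\mathcal T,\pi,i\models \psi\,\mathsf{U}\,\psi'$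 iff there is a position $j\ge i$ of $\pi$ with $\mathcal T,\pi,j\models\psi'$ and $\mathcal T,\pi,k\models\psi$ for all $i\le k<j$. Abbreviations: $\top,\bot,\wedge,\to,\leftrightarrow$ as usual; $\tilde{\mathsf{X}}\varphi=\neg\mathsf{X}\neg\varphi$ (true iff $\pi$ ends at $\pi(i)$ or $\varphi$ holds at $i+1$); $\mathsf{A}\varphi=\neg\mathsf{E}\neg\varphi$; $\varphi\,\mathsf{R}\,\psi=\neg(\neg\varphi\,\mathsf{U}\,\neg\psi)$. Two formulas are equivalent if for every $\Sigma$-tree $\mathcal T$ and every finite non-empty path $\pi$ of it, $\mathcal T,\pi,0\models\psi$ iff $\mathcal T,\pi,0\models\psi'$; a biconditional $\psi\leftrightarrow\psi'$ is valid iff $\psi$ and $\psi'$ are equivalent. -}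

module Defs where

open import Level using (0ℓ)
open import Data.Nat using (ℕ; zero; suc; _≤_; _<_)
open import Data.Fin using (Fin)
open import Data.Bool using (Bool; true)
open import Data.List using (List; []; _∷_; length; take)
open import Data.List.Membership.Propositional using (_∈_)
open import Data.Maybe using (Maybe; just; nothing)
open import Data.Product using (Σ; ∃; _×_)
open import Data.Sum using (_⊎_)
open import Relation.Nullary using (¬_)
open import Relation.Binary.PropositionalEquality using (_≡_; _≢_)
open import Function.Bundles using (_⇔_)

nth : {A : Set} → List A → ℕ → Maybe A
nth []       _       = nothing
nth (x ∷ xs) zero    = just x
nth (x ∷ xs) (suc i) = nth xs i

data Chain {A : Set} (R : A → A → Set) : A → List A → Set where
  []  : ∀ {x} → Chain R x []
  _∷_ : ∀ {x y ys} → R x y → Chain R y ys → Chain R x (y ∷ ys)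

-- Trees (unranked, unordered, possibly infinite, finitely branching,
-- every node has at least one child) labelled by Σ = 2^AP.
-- AP = Fin (suc k) (a finite, non-empty set of atomic propositions).

record ΣTree (k : ℕ) : Set₁ where
  field
    Node     : Set
    root     : Node
    children : Node → List Node
    -- τ(v) ⊆ AP, as a characteristic function
    label    : Node → Fin (suc k) → Bool
    children-nonempty : ∀ v → children v ≢ []
    root-no-parent    : ∀ u → ¬ (root ∈ children u)
    unique-parent     : ∀ u v w → w ∈ children u → w ∈ children v → u ≡ v
    reachable         : ∀ v → Σ (List Node) λ ws →
                          Chain (λ a b → b ∈ children a) root ws ×
                          nth (root ∷ ws) (length ws) ≡ just v

  Child : Node → Node → Set
  Child a b = b ∈ children a

open ΣTree public

record Path {k : ℕ} (T : ΣTree k) : Set where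
  constructor mkPath
  field
    rest  : List (Node T)
    chain : Chain (Child T) (root T) rest

  seq : List (Node T)
  seq = root T ∷ rest

  -- index of the last position
  len : ℕ
  len = length rest

open Path public

Agree : {k : ℕ} {T : ΣTree k} → Path T → Path T → ℕ → Set
Agree π π' i = i ≤ len π' × take (suc i) (seq π) ≡ take (suc i) (seq π')

infixl 6 _or_
infixl 7 _and_
infixr 5 _U_ _R_

data Fm (k : ℕ) : Set where
  D    : ℕ → Fm k → Fm k
  atom : Fin (suc k) → Fm k
  neg  : Fm k → Fm k
  _or_ : Fm k → Fm k → Fm k
  E    : Fm k → Fm k
  X    : Fm k → Fm k
  _U_  : Fm k → Fm k → Fm k

_and_ : ∀ {k} → Fm k → Fm k → Fm k
φ and ψ = neg (neg φ or neg ψ)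

tt : ∀ {k} → Fm k
tt = atom Fin.zero or neg (atom Fin.zero)
  where import Data.Fin as Fin

ff : ∀ {k} → Fm k
ff = neg tt

Xw : ∀ {k} → Fm k → Fm k
Xw φ = neg (X (neg φ))

A : ∀ {k} → Fm k → Fm k
A φ = neg (E (neg φ))

_R_ : ∀ {k} → Fm k → Fm k → Fm k
φ R ψ = neg (neg φ U neg ψ)

_iff_ : ∀ {k} → Fm k → Fm k → Fm k
φ iff ψ = (neg φ or ψ) and (neg ψ or φ)

αR : ∀ {k} → Fm k → Fm k → Fm k
αR φ ψ = ψ U ((Xw ff or φ) and ψ)

αU : ∀ {k} → Fm k → Fm k → Fm k
αU φ ψ = ψ R ((X tt and φ) or ψ)

-- Semantics: T , π , i ⊨ φ   (i is intended to be a position of π)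

Sat : ∀ {k} (T : ΣTree k) → Path T → ℕ → Fm k → Set
Sat T π i (D n φ) =
  i < len π ×
  Σ (Fin n → Path T) λ ps →
    (∀ j → Agree π (ps j) i × i < len (ps j) × Sat T (ps j) (suc i) φ) ×
    (∀ j j' → j ≢ j' → nth (seq (ps j)) (suc i) ≢ nth (seq (ps j')) (suc i))
Sat T π i (atom p) = ∃ λ v → nth (seq π) i ≡ just v × label T v p ≡ true
Sat T π i (neg φ)  = ¬ Sat T π i φ
Sat T π i (φ or ψ) = Sat T π i φ ⊎ Sat T π i ψ
Sat T π i (E φ)    = Σ (Path T) λ π' → Agree π π' i × Sat T π' i φ
Sat T π i (X φ)    = i < len π × Sat T π (suc i) φ
Sat T π i (φ U ψ)  =
  ∃ λ j → i ≤ j × j ≤ len π × Sat T π j ψ ×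
          (∀ m → i ≤ m → m < j → Sat T π m φ)

_≋_ : ∀ {k} → Fm k → Fm k → Set₁
φ ≋ ψ = ∀ (T : ΣTree _) (π : Path T) → Sat T π 0 φ ⇔ Sat T π 0 ψ

{-# OPTIONS --safe #-}
module Submission where

-- Each equivalence of items 2–6 holds at every position of a path, not only at its root,
-- and equivalence at every position is a congruence for all connectives; so items 3–6
-- follow from item 2. For item 2: on a finite path, φ R ψ says that ψ holds up to and
-- including the first φ-position, or up to the last position if there is none; that is
-- αR φ ψ, since X̃⊥ holds exactly at the last position. Dually, αU φ ψ says that φ holds,
-- and the path goes on, at every position before the first ψ-position, and that there is
-- such a position since X⊤ fails at the last one. Item 1 holds because the one-node path
-- ends at the root.

open import Defs
open import Level using (0ℓ)
open import Data.Nat using (ℕ; suc; _≤_; _<_; z≤n; _≤‴_; ≤‴-refl; ≤‴-step)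
open import Data.Nat.Properties
  using (≤-refl; ≤-trans; <⇒≤; <⇒≱; <-≤-trans; <-irrefl; <-cmp; m≤n⇒m<n∨m≡n; ≤⇒≤‴; ≤‴⇒≤)
open import Data.Product using (_×_; _,_; proj₁; proj₂; ∃)
open import Data.Sum using (_⊎_; inj₁; inj₂; [_,_]′)
open import Data.Empty using (⊥-elim)
open import Data.List using ([])
open import Relation.Nullary using (¬_; Dec; yes; no)
open import Relation.Nullary.Decidable using (toSum)
open import Relation.Binary using (tri<; tri≈; tri>)
open import Relation.Binary.PropositionalEquality using (_≡_; refl)
open import Function.Base using (id)
open import Function.Bundles using (mk⇔)
open import Axiom.ExcludedMiddle using (ExcludedMiddle)
open import Axiom.DoubleNegationElimination using (em⇒dne)

and⁺ : ∀ {P Q : Set} → P → Q → ¬ (¬ P ⊎ ¬ Q)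
and⁺ p q (inj₁ ¬p) = ¬p p
and⁺ p q (inj₂ ¬q) = ¬q q

All[_,_⟩ : ℕ → ℕ → (ℕ → Set) → Set
All[ i , j ⟩ P = ∀ m → i ≤ m → m < j → P m

All-empty : ∀ {P i} → All[ i , i ⟩ P
All-empty m i≤m m<i = ⊥-elim (<⇒≱ m<i i≤m)

All-cons : ∀ {P i j} → P i → All[ suc i , j ⟩ P → All[ i , j ⟩ P
All-cons Pi rest m i≤m m<j with m≤n⇒m<n∨m≡n i≤m
... | inj₁ i<m  = rest m i<m m<j
... | inj₂ refl = Pi

All-prefix : ∀ {P i j j′} → j ≤ j′ → All[ i , j′ ⟩ P → All[ i , j ⟩ P
All-prefix j≤j′ all m i≤m m<j = all m i≤m (<-≤-trans m<j j≤j′)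

first-hit : ∀ {P : ℕ → Set} → (∀ m → Dec (P m)) → ∀ {i L} → i ≤‴ L →
            ∃ λ j → i ≤ j × j ≤ L × (j ≡ L ⊎ P j) × All[ i , j ⟩ (λ m → ¬ P m)
first-hit P? {i} i≤L with P? i | i≤L
... | yes Pi | _ = i , ≤-refl , ≤‴⇒≤ i≤L , inj₂ Pi , All-empty
... | no ¬Pi | ≤‴-refl = i , ≤-refl , ≤-refl , inj₁ refl , All-empty
... | no ¬Pi | ≤‴-step i<L with first-hit P? i<L
...   | j , i<j , j≤L , hit , ¬P-before = j , <⇒≤ i<j , j≤L , hit , All-cons ¬Pi ¬P-before

module _ {k : ℕ} where

  -- Positions are bounded by the end of the path: beyond it φ R ψ holds vacuously
  -- while αR φ ψ fails.
  infix 4 _⊑_ _≈_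
  _⊑_ : Fm k → Fm k → Set₁
  a ⊑ b = ∀ {T : ΣTree k} (π : Path T) i → i ≤ len π → Sat T π i a → Sat T π i b

  record _≈_ (a b : Fm k) : Set₁ where
    constructor mk≈
    field
      ≈⇒⊑ : a ⊑ b
      ≈⇒⊒ : b ⊑ a

  ≈⇒≋ : ∀ {a b} → a ≈ b → a ≋ b
  ≈⇒≋ (mk≈ a⊑b b⊑a) T π = mk⇔ (a⊑b π 0 z≤n) (b⊑a π 0 z≤n)

  neg-antitone : ∀ {a b} → a ⊑ b → neg b ⊑ neg a
  neg-antitone a⊑b π i i≤L ¬b a = ¬b (a⊑b π i i≤L a)

  E-mono : ∀ {a b} → a ⊑ b → E a ⊑ E b
  E-mono a⊑b π i _ (π′ , agree , a) = π′ , agree , a⊑b π′ i (proj₁ agree) a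

  X-mono : ∀ {a b} → a ⊑ b → X a ⊑ X b
  X-mono a⊑b π i _ (i<L , a) = i<L , a⊑b π (suc i) i<L a

  U-mono : ∀ {a a′ b b′} → a ⊑ a′ → b ⊑ b′ → a U b ⊑ a′ U b′
  U-mono a⊑a′ b⊑b′ π i _ (j , i≤j , j≤L , b , a-before) =
    j , i≤j , j≤L , b⊑b′ π j j≤L b ,
    λ m i≤m m<j → a⊑a′ π m (≤-trans (<⇒≤ m<j) j≤L) (a-before m i≤m m<j)

  ≈-refl : ∀ {a} → a ≈ a
  ≈-refl = mk≈ (λ _ _ _ → id) (λ _ _ _ → id)

  neg-cong : ∀ {a b} → a ≈ b → neg a ≈ neg b
  neg-cong (mk≈ a⊑b b⊑a) = mk≈ (neg-antitone b⊑a) (neg-antitone a⊑b)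

  E-cong : ∀ {a b} → a ≈ b → E a ≈ E b
  E-cong (mk≈ a⊑b b⊑a) = mk≈ (E-mono a⊑b) (E-mono b⊑a)

  X-cong : ∀ {a b} → a ≈ b → X a ≈ X b
  X-cong (mk≈ a⊑b b⊑a) = mk≈ (X-mono a⊑b) (X-mono b⊑a)

  U-cong : ∀ {a a′ b b′} → a ≈ a′ → b ≈ b′ → a U b ≈ a′ U b′
  U-cong (mk≈ a⊑a′ a′⊑a) (mk≈ b⊑b′ b′⊑b) = mk≈ (U-mono a⊑a′ b⊑b′) (U-mono a′⊑a b′⊑b)

  R-cong : ∀ {a a′ b b′} → a ≈ a′ → b ≈ b′ → a R b ≈ a′ R b′
  R-cong a≈a′ b≈b′ = neg-cong (U-cong (neg-cong a≈a′) (neg-cong b≈b′))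

  A-cong : ∀ {a b} → a ≈ b → A a ≈ A b
  A-cong a≈b = neg-cong (E-cong (neg-cong a≈b))

  Xw-cong : ∀ {a b} → a ≈ b → Xw a ≈ Xw b
  Xw-cong a≈b = neg-cong (X-cong (neg-cong a≈b))

  root-path : ∀ {T : ΣTree k} → Path T
  root-path = mkPath [] []

  E-neg-X-at-root : ∀ {T : ΣTree k} (π : Path T) φ → Sat T π 0 (E (neg (X φ)))
  E-neg-X-at-root π φ = root-path , (z≤n , refl) , λ ()

  module _ (lem : ExcludedMiddle 0ℓ) where

    -- Sat T π i tt is an instance of em, as tt is p ∨ ¬p for a fixed atom p.
    em : ∀ {P : Set} → P ⊎ ¬ P
    em = toSum lem

    dne : ∀ {P : Set} → ¬ ¬ P → P
    dne = em⇒dne lem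

    and⁻ : ∀ {P Q : Set} → ¬ (¬ P ⊎ ¬ Q) → P × Q
    and⁻ ¬[¬P⊎¬Q] = dne (λ ¬P → ¬[¬P⊎¬Q] (inj₁ ¬P)) , dne (λ ¬Q → ¬[¬P⊎¬Q] (inj₂ ¬Q))

    R⊑αR : ∀ {φ ψ} → φ R ψ ⊑ αR φ ψ
    R⊑αR {φ} {ψ} π i i≤L r with first-hit (λ _ → lem) (≤⇒≤‴ i≤L)
    ... | j , i≤j , j≤L , hit , ¬φ-before =
      j , i≤j , j≤L , and⁺ (stop hit) (ψ-upto j i≤j ≤-refl) ,
      λ m i≤m m<j → ψ-upto m i≤m (<⇒≤ m<j)
      where
      ψ-upto : ∀ m → i ≤ m → m ≤ j → Sat _ π m ψ
      ψ-upto m i≤m m≤j = dne λ ¬ψ → r (m , i≤m , ≤-trans m≤j j≤L , ¬ψ , All-prefix m≤j ¬φ-before)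
      stop : j ≡ len π ⊎ Sat _ π j φ → Sat _ π j (Xw ff or φ)
      stop (inj₁ refl) = inj₁ λ (j<L , _) → <-irrefl refl j<L
      stop (inj₂ φj)   = inj₂ φj

    αR⊑R : ∀ {φ ψ} → αR φ ψ ⊑ φ R ψ
    αR⊑R {φ} {ψ} π i _ (j , i≤j , j≤L , stop∧ψ , ψ-before) (j′ , i≤j′ , j′≤L , ¬ψ , ¬φ-before)
      with <-cmp j′ j
    ... | tri< j′<j _ _ = ¬ψ (ψ-before j′ i≤j′ j′<j)
    ... | tri≈ _ refl _ = ¬ψ (proj₂ (and⁻ stop∧ψ))
    ... | tri> _ _ j<j′ =
      [ (λ last → last (<-≤-trans j<j′ j′≤L , λ ¬tt → ¬tt em)) , ¬φ-before j i≤j j<j′ ]′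
        (proj₁ (and⁻ stop∧ψ))

    U⊑αU : ∀ {φ ψ} → φ U ψ ⊑ αU φ ψ
    U⊑αU π i _ (j , i≤j , j≤L , ψj , φ-before) (j′ , i≤j′ , j′≤L , ¬B , ¬ψ-before)
      with <-cmp j′ j
    ... | tri< j′<j _ _ = ¬B (inj₁ (and⁺ (<-≤-trans j′<j j≤L , em) (φ-before j′ i≤j′ j′<j)))
    ... | tri≈ _ refl _ = ¬B (inj₂ ψj)
    ... | tri> _ _ j<j′ = ¬ψ-before j i≤j j<j′ ψj

    αU⊑U : ∀ {φ ψ} → αU φ ψ ⊑ φ U ψ
    αU⊑U {φ} {ψ} π i i≤L h with first-hit (λ _ → lem) (≤⇒≤‴ i≤L)
    ... | j , i≤j , j≤L , hit , ¬ψ-before =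
      j , i≤j , j≤L , ψ-at-j hit ,
      λ m i≤m m<j → proj₂ (continues-with-φ m i≤m (<⇒≤ m<j) (¬ψ-before m i≤m m<j))
      where
      continues-with-φ : ∀ m → i ≤ m → m ≤ j → ¬ Sat _ π m ψ → m < len π × Sat _ π m φ
      continues-with-φ m i≤m m≤j ¬ψ
        with dne (λ ¬B → h (m , i≤m , ≤-trans m≤j j≤L , ¬B , All-prefix m≤j ¬ψ-before))
      ... | inj₁ Xtt∧φ = let (m<L , _) , φm = and⁻ Xtt∧φ in m<L , φm
      ... | inj₂ ψm    = ⊥-elim (¬ψ ψm)
      ψ-at-j : j ≡ len π ⊎ Sat _ π j ψ → Sat _ π j ψ
      ψ-at-j (inj₁ refl) = dne λ ¬ψ → <-irrefl refl (proj₁ (continues-with-φ j i≤j ≤-refl ¬ψ))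
      ψ-at-j (inj₂ ψj) = ψj

    R≈αR : ∀ φ ψ → φ R ψ ≈ αR φ ψ
    R≈αR φ ψ = mk≈ R⊑αR αR⊑R

    U≈αU : ∀ φ ψ → φ U ψ ≈ αU φ ψ
    U≈αU φ ψ = mk≈ U⊑αU αU⊑U

    E-Xw≋tt : ∀ φ → E (Xw φ) ≋ tt
    E-Xw≋tt φ T π = mk⇔ (λ _ → em) (λ _ → E-neg-X-at-root π (neg φ))

    A-X≋ff : ∀ φ → A (X φ) ≋ ff
    A-X≋ff φ T π = mk⇔ (λ ¬E → ⊥-elim (¬E (E-neg-X-at-root π φ))) (λ ¬tt → ⊥-elim (¬tt em))

proposition4 : ExcludedMiddle 0ℓ →
    ∀ {k : ℕ} (φ ψ γ : Fm k) →
      -- 1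
      ((E (Xw φ) ≋ tt) × (A (X φ) ≋ ff)) ×
      -- 2
      (((φ R ψ) ≋ αR φ ψ) × ((φ U ψ) ≋ αU φ ψ)) ×
      -- 3
      ((E (φ R ψ) ≋ E (αR φ ψ)) × (A (φ U ψ) ≋ A (αU φ ψ))) ×
      -- 4
      ((E (X (φ R ψ)) ≋ E (X (αR φ ψ))) × (A (Xw (φ U ψ)) ≋ A (Xw (αU φ ψ)))) ×
      -- 5
      ((E (φ U (ψ R γ)) ≋ E (φ U αR ψ γ)) × (A (φ R (ψ U γ)) ≋ A (φ R αU ψ γ))) ×
      -- 6
      ((E ((φ R ψ) U γ) ≋ E (αR φ ψ U γ)) × (A ((φ U ψ) R γ) ≋ A (αU φ ψ R γ)))
proposition4 lem φ ψ γ =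
  (E-Xw≋tt lem φ , A-X≋ff lem φ) ,
  (≈⇒≋ (R≈αR lem φ ψ) , ≈⇒≋ (U≈αU lem φ ψ)) ,
  (≈⇒≋ (E-cong (R≈αR lem φ ψ)) , ≈⇒≋ (A-cong (U≈αU lem φ ψ))) ,
  (≈⇒≋ (E-cong (X-cong (R≈αR lem φ ψ))) , ≈⇒≋ (A-cong (Xw-cong (U≈αU lem φ ψ)))) ,
  (≈⇒≋ (E-cong (U-cong (≈-refl {a = φ}) (R≈αR lem ψ γ))) ,
   ≈⇒≋ (A-cong (R-cong (≈-refl {a = φ}) (U≈αU lem ψ γ)))) ,
  (≈⇒≋ (E-cong (U-cong (R≈αR lem φ ψ) (≈-refl {a = γ}))) ,
   ≈⇒≋ (A-cong (R-cong (U≈αU lem φ ψ) (≈-refl {a = γ}))))
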